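{- Let $m\in\mathbb{N}$, $a\in\mathrm{R}_m$ and $k,l\in\mathbb{N}$. Then: 1. if $a^k\bmod m\in\mathrm{E}_m$ then $|a|_m\mid k$; 2. $|a|_m\mid\varphi(m)$; 3. $a^k\equiv a^l\pmod m$ if and only if $k\equiv l\pmod{|a|_m}$; 4. $|a^k|_m=|a|_m/(k,|a|_m)$.
   Context: $\mathbb{N}=\{1,2,\dots\}$, $\mathbb{Z}_m=\{1,\dots,m\}$, $\varphi$ is Euler's totient function, $(u,v)$ is the gcd. $\mathrm{E}_m=\{e\in\mathbb{Z}_m: e^2\equiv e\pmod m\}$. For $a\in\mathbb{Z}$, the order $|a|_m$ is the smallest $n\in\mathbb{N}$ with $a^n\bmod m\in\mathrm{E}_m$ (where $x\bmod m$ is the element of $\mathbb{Z}_m$ congruent to $x$). $a\in\mathbb{Z}_m$ is regular if $a^{|a|_m+1}\equiv a\pmod m$; $\mathrm{R}_m$ is the set of regular residues. -}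

module Defs where

open import Data.Nat using (ℕ; zero; suc; _+_; _*_; _^_; _≤_; _<_; NonZero; ∣_-_∣)
open import Data.Nat.DivMod using (_%_)
open import Data.Nat.Divisibility using (_∣_)
open import Data.Nat.GCD using (gcd)
open import Data.List using (List; length; filter; upTo; map)
open import Data.Product using (_×_; ∃)
open import Data.Empty using (⊥)
open import Relation.Nullary.Decidable using (does)
open import Data.Nat.Properties using (_≟_)

infix 4 _≡_[mod_]
_≡_[mod_] : ℕ → ℕ → ℕ → Set
x ≡ y [mod n ] = n ∣ ∣ x - y ∣

-- x mod m as the element of ℤ_m = {1,…,m} congruent to x (m ≥ 1).
infixl 7 _mod_
_mod_ : ℕ → (m : ℕ) → .{{NonZero m}} → ℕ
x mod m with x % m
... | zero  = m
... | suc r = suc r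

InE : (m : ℕ) → ℕ → Set
InE m e = (1 ≤ e × e ≤ m) × (e * e ≡ e [mod m ])

IsOrder : (m : ℕ) → .{{NonZero m}} → ℕ → ℕ → Set
IsOrder m a n =
  1 ≤ n × InE m ((a ^ n) mod m) × (∀ j → 1 ≤ j → j < n → InE m ((a ^ j) mod m) → ⊥)

Regular : (m : ℕ) → .{{NonZero m}} → ℕ → Set
Regular m a = (1 ≤ a × a ≤ m) × ∃ λ n → IsOrder m a n × (a ^ (n + 1) ≡ a [mod m ])

φ : ℕ → ℕ
φ m = length (filter (λ i → gcd i m ≟ 1) (map suc (upTo m)))

-- Total natural-number division (x ÷ 0 = 0 by convention; only used with a nonzero divisor).
open import Data.Nat using (_/_)
_÷_ : ℕ → ℕ → ℕ
x ÷ zero  = zero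
x ÷ suc y = x / suc y

module Submission where

-- We compute with x ≈ y := x % m ≡ y % m (module Congruence), which agrees with
-- the divisibility congruence of the statement and is compatible with +, * and ^;
-- since x mod m is determined by x % m, "x mod m ∈ E_m" just says x·x ≈ x.
-- Regularity gives a^(n+1) ≈ a, so positive exponents may be shifted by
-- multiples of n (module Powers). As e = a^n is idempotent and no smaller positive
-- power is, the period is exact: a^k ≈ a^(k+d) iff n ∣ d. This yields (1), (3),
-- and (4), the last via the arithmetic fact that n/gcd(k,n) is the least j ≥ 1
-- with n ∣ k·j. For (2), w = 1 - e makes u = a + w a unit with u^j ≈ a^j + w;
-- Euler's theorem u^φ(m) ≈ 1 (proved in module Euler by the classical
-- permutation of reduced residues) then gives a^φ(m) ≈ e, hence n ∣ φ(m) by (1).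

open import Defs
open import Data.Nat
open import Data.Nat.Properties
open import Data.Nat.DivMod hiding (_mod_)
open import Data.Nat.Divisibility
open import Data.Product using (_×_; _,_; proj₁; proj₂)
open import Data.Sum using (inj₁; inj₂)
open import Data.Empty using (⊥; ⊥-elim)
open import Relation.Nullary using (¬_)
open import Data.List using (List; []; _∷_; map; filter; upTo; length)
open import Data.List.Membership.Propositional using (_∈_)
open import Data.List.Membership.Propositional.Properties using (∈-map⁺; ∈-map⁻; ∈-filter⁺; ∈-filter⁻; ∈-upTo⁺; ∈-upTo⁻)
open import Data.List.Membership.Propositional.Properties.WithK using (unique∧set⇒bag)
open import Data.List.Relation.Binary.BagAndSetEquality using (∼bag⇒↭; bag; _∼[_]_)
open import Data.List.Relation.Unary.Any using (here; there)
import Data.List.Relation.Unary.All as All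
import Data.List.Relation.Unary.All.Properties as AllP
open import Data.List.Relation.Unary.Unique.Propositional using (Unique; []; _∷_)
import Data.List.Relation.Unary.Unique.Propositional.Properties as Unique
open import Data.Nat.ListAction using (product)
open import Data.Nat.ListAction.Properties using (product-↭)
open import Data.Nat.GCD using (gcd; gcd[m,n]≢0; gcd[m,n]∣m; gcd[m,n]∣n; n/gcd[m,n]≢0)
open import Data.Nat.Coprimality as Coprimality using (Coprime; coprime-divisor; coprime-/gcd)
open import Function.Bundles using (_⇔_; mk⇔)
open import Function.Properties.Equivalence using () renaming (trans to ⇔-trans)
open import Relation.Binary.Definitions using (tri<; tri≈; tri>)
open import Relation.Binary.PropositionalEquality
open import Relation.Binary.Bundles using (Setoid)
import Relation.Binary.Reasoning.Setoid as SetoidReasoning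

-- Every pair of naturals has the form (x, x + d) or (y + d, y); statements
-- about ∣ x - y ∣ are reduced to the gap d by matching on this view.
data Gap : ℕ → ℕ → Set where
  below : ∀ x d → Gap x (x + d)
  above : ∀ y d → Gap (y + d) y

gap : ∀ x y → Gap x y
gap x y with ≤-total x y
... | inj₁ x≤y = subst (Gap x) (m+[n∸m]≡n x≤y) (below x (y ∸ x))
... | inj₂ y≤x = subst (λ z → Gap z y) (m+[n∸m]≡n y≤x) (above y (x ∸ y))

∣m+n-m∣≡n : ∀ m n → ∣ m + n - m ∣ ≡ n
∣m+n-m∣≡n m n = trans (∣-∣-comm (m + n) m) (∣m-m+n∣≡n m n)

∣-∣-divisor : ∀ {d x y} → d ∣ x → d ∣ ∣ x - y ∣ → d ∣ y
∣-∣-divisor {d} {x} {y} d∣x d∣δ with gap x y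
... | below x e = ∣m∣n⇒∣m+n d∣x (subst (d ∣_) (∣m-m+n∣≡n x e) d∣δ)
... | above y e = ∣m+n∣m⇒∣n (subst (d ∣_) (+-comm y e) d∣x) (subst (d ∣_) (∣m+n-m∣≡n y e) d∣δ)

map-unique : ∀ {A B : Set} (f : A → B) {xs} → (∀ {x y} → x ∈ xs → y ∈ xs → f x ≡ f y → x ≡ y) →
             Unique xs → Unique (map f xs)
map-unique f {[]}     inj []         = []
map-unique f {x ∷ xs} inj (x∉ ∷ uxs) =
  AllP.map⁺ (All.tabulate λ y∈ fx≡fy → All.lookup x∉ y∈ (inj (here refl) (there y∈) fx≡fy))
  ∷ map-unique f (λ p q → inj (there p) (there q)) uxs

-- With g = gcd(k, n): n divides k·(n/g), and n ∣ k·j forces n/g ∣ j, because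
-- k/g and n/g are coprime. Together: n/g is the least j ≥ 1 with n ∣ k·j.
n∣k*[n/gcd] : ∀ k n .{{_ : NonZero (gcd k n)}} → n ∣ k * (n / gcd k n)
n∣k*[n/gcd] k n = subst (n ∣_) reassociate (m∣m*n (k / gcd k n))
  where
  open ≡-Reasoning
  reassociate : n * (k / gcd k n) ≡ k * (n / gcd k n)
  reassociate = begin
    n * (k / gcd k n) ≡⟨ sym (*-/-assoc n (gcd[m,n]∣m k n)) ⟩
    n * k / gcd k n   ≡⟨ cong (_/ gcd k n) (*-comm n k) ⟩
    k * n / gcd k n   ≡⟨ *-/-assoc k (gcd[m,n]∣n k n) ⟩
    k * (n / gcd k n) ∎

n∣k*j⇒n/gcd∣j : ∀ k n j .{{_ : NonZero (gcd k n)}} → n ∣ k * j → n / gcd k n ∣ j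
n∣k*j⇒n/gcd∣j k n j n∣kj =
  coprime-divisor (Coprimality.sym (coprime-/gcd k n)) (*-cancelʳ-∣ g (subst₂ _∣_ n≡n/g*g kj≡k/g*j*g n∣kj))
  where
  open ≡-Reasoning
  g = gcd k n
  n≡n/g*g : n ≡ n / g * g
  n≡n/g*g = sym (m/n*n≡m (gcd[m,n]∣n k n))
  kj≡k/g*j*g : k * j ≡ k / g * j * g
  kj≡k/g*j*g = begin
    k * j           ≡⟨ cong (_* j) (sym (m/n*n≡m (gcd[m,n]∣m k n))) ⟩
    k / g * g * j   ≡⟨ *-assoc (k / g) g j ⟩
    k / g * (g * j) ≡⟨ cong (k / g *_) (*-comm g j) ⟩
    k / g * (j * g) ≡⟨ sym (*-assoc (k / g) j g) ⟩
    k / g * j * g   ∎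

order-unique : ∀ m .{{_ : NonZero m}} a {n n'} → IsOrder m a n → IsOrder m a n' → n ≡ n'
order-unique m a {n} {n'} (1≤n , n∈E , below-n) (1≤n' , n'∈E , below-n') with <-cmp n n'
... | tri< n<n' _ _ = ⊥-elim (below-n' n 1≤n n<n' n∈E)
... | tri≈ _ n≡n' _ = n≡n'
... | tri> _ _ n>n' = ⊥-elim (below-n n' 1≤n' n>n' n'∈E)

÷≡/ : ∀ x y .{{_ : NonZero y}} → x ÷ y ≡ x / y
÷≡/ x (suc y) = refl

module Congruence (m : ℕ) .{{_ : NonZero m}} where

  infix 4 _≈_
  _≈_ : ℕ → ℕ → Set
  x ≈ y = x % m ≡ y % m

  ≈-setoid : Setoid _ _
  ≈-setoid = record { Carrier = ℕ ; _≈_ = _≈_ ; isEquivalence = record { refl = refl ; sym = sym ; trans = trans } }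

  module ≈-Reasoning = SetoidReasoning ≈-setoid

  shift-≈⇒∣ : ∀ x d → x + d ≈ x → m ∣ d
  shift-≈⇒∣ x d eq = ∣m+n∣m⇒∣n (subst (m ∣_) (sym quotients) (n∣m*n ((x + d) / m))) (n∣m*n (x / m))
    where
    open ≡-Reasoning
    quotients : (x / m) * m + d ≡ ((x + d) / m) * m
    quotients = +-cancelˡ-≡ (x % m) _ _ (begin
      x % m + ((x / m) * m + d)       ≡⟨ sym (+-assoc (x % m) _ d) ⟩
      x % m + (x / m) * m + d         ≡⟨ cong (_+ d) (sym (m≡m%n+[m/n]*n x m)) ⟩
      x + d                           ≡⟨ m≡m%n+[m/n]*n (x + d) m ⟩
      (x + d) % m + ((x + d) / m) * m ≡⟨ cong (_+ ((x + d) / m) * m) eq ⟩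
      x % m + ((x + d) / m) * m       ∎)

  ≡mod⇒≈ : ∀ {x y} → x ≡ y [mod m ] → x ≈ y
  ≡mod⇒≈ {x} {y} p with gap x y
  ... | below x d = sym (%-remove-+ʳ x (subst (m ∣_) (∣m-m+n∣≡n x d) p))
  ... | above y d = %-remove-+ʳ y (subst (m ∣_) (∣m+n-m∣≡n y d) p)

  ≈⇒≡mod : ∀ {x y} → x ≈ y → x ≡ y [mod m ]
  ≈⇒≡mod {x} {y} p with gap x y
  ... | below x d = subst (m ∣_) (sym (∣m-m+n∣≡n x d)) (shift-≈⇒∣ x d (sym p))
  ... | above y d = subst (m ∣_) (sym (∣m+n-m∣≡n y d)) (shift-≈⇒∣ y d p)

  ≡mod⇔≈ : ∀ {x y} → x ≡ y [mod m ] ⇔ x ≈ y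
  ≡mod⇔≈ = mk⇔ ≡mod⇒≈ ≈⇒≡mod

  +-cong : ∀ {a b c d} → a ≈ b → c ≈ d → a + c ≈ b + d
  +-cong {a} {b} {c} {d} p q = begin
    (a + c) % m         ≡⟨ %-distribˡ-+ a c m ⟩
    (a % m + c % m) % m ≡⟨ cong₂ (λ u v → (u + v) % m) p q ⟩
    (b % m + d % m) % m ≡⟨ sym (%-distribˡ-+ b d m) ⟩
    (b + d) % m         ∎
    where open ≡-Reasoning

  *-cong : ∀ {a b c d} → a ≈ b → c ≈ d → a * c ≈ b * d
  *-cong {a} {b} {c} {d} p q = begin
    (a * c) % m           ≡⟨ %-distribˡ-* a c m ⟩
    (a % m * (c % m)) % m ≡⟨ cong₂ (λ u v → (u * v) % m) p q ⟩
    (b % m * (d % m)) % m ≡⟨ sym (%-distribˡ-* b d m) ⟩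
    (b * d) % m           ∎
    where open ≡-Reasoning

  ^-cong : ∀ {a b} j → a ≈ b → a ^ j ≈ b ^ j
  ^-cong zero    p = refl
  ^-cong (suc j) p = *-cong p (^-cong j p)

  +-cancelʳ : ∀ x y z → x + z ≈ y + z → x ≈ y
  +-cancelʳ x y z p = ≡mod⇒≈ (subst (m ∣_) same-gap (≈⇒≡mod p))
    where
    same-gap : ∣ x + z - y + z ∣ ≡ ∣ x - y ∣
    same-gap = trans (cong₂ ∣_-_∣ (+-comm x z) (+-comm y z)) (∣m+n-m+o∣≡∣n-o∣ z x y)

  representative : ℕ → ℕ
  representative zero    = m
  representative (suc r) = suc r

  mod≡representative : ∀ x → x mod m ≡ representative (x % m)
  mod≡representative x with x % m
  ... | zero  = refl
  ... | suc r = refl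

  mod-cong : ∀ {x y} → x ≈ y → x mod m ≡ y mod m
  mod-cong {x} {y} p = trans (mod≡representative x) (trans (cong representative p) (sym (mod≡representative y)))

  mod-≈ : ∀ x → x mod m ≈ x
  mod-≈ x with x % m in eq
  ... | zero  = n%n≡0 m
  ... | suc r = m<n⇒m%n≡m (subst (_< m) eq (m%n<n x m))

  mod-range : ∀ x → 1 ≤ x mod m × x mod m ≤ m
  mod-range x with x % m in eq
  ... | zero  = >-nonZero⁻¹ m , ≤-refl
  ... | suc r = s≤s z≤n , <⇒≤ (subst (_< m) eq (m%n<n x m))

  mod-fixed : ∀ x → 1 ≤ x → x ≤ m → x mod m ≡ x
  mod-fixed x 1≤x x≤m with m≤n⇒m<n∨m≡n x≤m
  ... | inj₂ refl = trans (mod≡representative x) (cong representative (n%n≡0 x))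
  ... | inj₁ x<m  = trans (mod≡representative x) (trans (cong representative (m<n⇒m%n≡m x<m)) (positive 1≤x))
    where
    positive : ∀ {y} → 1 ≤ y → representative y ≡ y
    positive {suc y} _ = refl

  Idempotent : ℕ → Set
  Idempotent x = x * x ≈ x

  idempotent-resp-≈ : ∀ {x y} → x ≈ y → Idempotent x → Idempotent y
  idempotent-resp-≈ x≈y idem = trans (*-cong (sym x≈y) (sym x≈y)) (trans idem x≈y)

  InE⇒idempotent : ∀ x → InE m (x mod m) → Idempotent x
  InE⇒idempotent x (_ , p) = begin
    x * x                 ≈⟨ *-cong (sym (mod-≈ x)) (sym (mod-≈ x)) ⟩
    (x mod m) * (x mod m) ≈⟨ ≡mod⇒≈ p ⟩
    x mod m               ≈⟨ mod-≈ x ⟩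
    x                     ∎
    where open ≈-Reasoning

  idempotent⇒InE : ∀ x → Idempotent x → InE m (x mod m)
  idempotent⇒InE x p = mod-range x , ≈⇒≡mod (begin
    (x mod m) * (x mod m) ≈⟨ *-cong (mod-≈ x) (mod-≈ x) ⟩
    x * x                 ≈⟨ p ⟩
    x                     ≈⟨ sym (mod-≈ x) ⟩
    x mod m               ∎)
    where open ≈-Reasoning

module Euler (m : ℕ) .{{_ : NonZero m}} where
  open Congruence m

  unit⇒coprime : ∀ u v → u * v ≈ 1 → Coprime u m
  unit⇒coprime u v uv (d∣u , d∣m) = ∣1⇒≡1 (∣-∣-divisor (∣m⇒∣m*n v d∣u) (∣-trans d∣m (≈⇒≡mod uv)))

  coprime-resp-≈ : ∀ {x y} → x ≈ y → Coprime y m → Coprime x m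
  coprime-resp-≈ x≈y cy (d∣x , d∣m) = cy (∣n∣m%n⇒∣m d∣m (subst (_ ∣_) x≈y (%-presˡ-∣ d∣x d∣m)) , d∣m)

  coprime-* : ∀ {x y} → Coprime x m → Coprime y m → Coprime (x * y) m
  coprime-* cx cy (d∣xy , d∣m) = cy (coprime-divisor (λ (e∣d , e∣x) → cx (e∣x , ∣-trans e∣d d∣m)) d∣xy , d∣m)

  coprime-product : ∀ xs → (∀ {x} → x ∈ xs → Coprime x m) → Coprime (product xs) m
  coprime-product []       c = Coprimality.1-coprimeTo m
  coprime-product (x ∷ xs) c = coprime-* (c (here refl)) (coprime-product xs (λ p → c (there p)))

  reduced : List ℕ
  reduced = filter (λ i → gcd i m ≟ 1) (map suc (upTo m))

  ∈reduced⁻ : ∀ {x} → x ∈ reduced → (1 ≤ x × x ≤ m) × Coprime x m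
  ∈reduced⁻ p with ∈-filter⁻ (λ i → gcd i m ≟ 1) {xs = map suc (upTo m)} p
  ... | q , gcd≡1 with ∈-map⁻ suc q
  ...   | y , y∈ , refl = (s≤s z≤n , ∈-upTo⁻ y∈) , Coprimality.gcd≡1⇒coprime gcd≡1

  ∈reduced⁺ : ∀ {x} → (1 ≤ x × x ≤ m) → Coprime x m → x ∈ reduced
  ∈reduced⁺ {suc y} (_ , x≤m) c =
    ∈-filter⁺ (λ i → gcd i m ≟ 1) (∈-map⁺ suc (∈-upTo⁺ x≤m)) (Coprimality.coprime⇒gcd≡1 c)

  reduced-unique : Unique reduced
  reduced-unique = Unique.filter⁺ (λ i → gcd i m ≟ 1) (Unique.map⁺ suc-injective (Unique.upTo⁺ m))

  φ-positive : 1 ≤ φ m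
  φ-positive = nonempty (∈reduced⁺ (≤-refl , >-nonZero⁻¹ m) (Coprimality.1-coprimeTo m))
    where
    nonempty : ∀ {x : ℕ} {xs} → x ∈ xs → 1 ≤ length xs
    nonempty (here _)  = s≤s z≤n
    nonempty (there _) = s≤s z≤n

  -- Multiplication by a unit u (with inverse v) permutes the reduced residues.
  module Scaling (u v : ℕ) (uv : u * v ≈ 1) where

    scale : ℕ → ℕ
    scale x = (u * x) mod m

    v-cancels-u : ∀ x → v * (u * x) ≈ x
    v-cancels-u x = begin
      v * (u * x) ≡⟨ sym (*-assoc v u x) ⟩
      v * u * x   ≡⟨ cong (_* x) (*-comm v u) ⟩
      u * v * x   ≈⟨ *-cong uv (refl {x = x % m}) ⟩
      1 * x       ≡⟨ *-identityˡ x ⟩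
      x           ∎
      where open ≈-Reasoning

    u-cancels-v : ∀ x → u * (v * x) ≈ x
    u-cancels-v x = begin
      u * (v * x) ≡⟨ sym (*-assoc u v x) ⟩
      u * v * x   ≈⟨ *-cong uv (refl {x = x % m}) ⟩
      1 * x       ≡⟨ *-identityˡ x ⟩
      x           ∎
      where open ≈-Reasoning

    fixed : ∀ {x} → x ∈ reduced → x mod m ≡ x
    fixed {x} p = mod-fixed x (proj₁ (proj₁ (∈reduced⁻ p))) (proj₂ (proj₁ (∈reduced⁻ p)))

    times-unit∈ : ∀ w {x} → Coprime w m → x ∈ reduced → (w * x) mod m ∈ reduced
    times-unit∈ w {x} cw p =
      ∈reduced⁺ (mod-range (w * x)) (coprime-resp-≈ (mod-≈ (w * x)) (coprime-* cw (proj₂ (∈reduced⁻ p))))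

    scale-injective : ∀ {x y} → x ∈ reduced → y ∈ reduced → scale x ≡ scale y → x ≡ y
    scale-injective {x} {y} px py eq = trans (sym (fixed px)) (trans (mod-cong x≈y) (fixed py))
      where
      open ≈-Reasoning
      x≈y : x ≈ y
      x≈y = begin
        x           ≈⟨ sym (v-cancels-u x) ⟩
        v * (u * x) ≈⟨ *-cong (refl {x = v % m}) (trans (sym (mod-≈ (u * x))) (trans (cong (_% m) eq) (mod-≈ (u * y)))) ⟩
        v * (u * y) ≈⟨ v-cancels-u y ⟩
        y           ∎

    scale-surjective : ∀ {x} → x ∈ reduced → x ∈ map scale reduced
    scale-surjective {x} px = subst (_∈ map scale reduced) scale-preimage
                                    (∈-map⁺ scale (times-unit∈ v (unit⇒coprime v u v≈1) px))
      where
      v≈1 : v * u ≈ 1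
      v≈1 = subst (λ z → z ≈ 1) (*-comm u v) uv
      scale-preimage : scale ((v * x) mod m) ≡ x
      scale-preimage = trans (mod-cong (trans (*-cong (refl {x = u % m}) (mod-≈ (v * x))) (u-cancels-v x))) (fixed px)

    scale-permutes : map scale reduced ∼[ bag ] reduced
    scale-permutes = unique∧set⇒bag (map-unique scale scale-injective reduced-unique) reduced-unique
                                    (mk⇔ into scale-surjective)
      where
      into : ∀ {x} → x ∈ map scale reduced → x ∈ reduced
      into p with ∈-map⁻ scale p
      ... | y , y∈ , refl = times-unit∈ u (unit⇒coprime u v uv) y∈

    product-scaled : ∀ xs → product (map scale xs) ≈ u ^ length xs * product xs
    product-scaled []       = refl
    product-scaled (x ∷ xs) = begin
      scale x * product (map scale xs)       ≈⟨ *-cong (mod-≈ (u * x)) (product-scaled xs) ⟩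
      (u * x) * (u ^ length xs * product xs) ≡⟨ [m*n]*[o*p]≡[m*o]*[n*p] u x (u ^ length xs) (product xs) ⟩
      (u * u ^ length xs) * (x * product xs) ∎
      where open ≈-Reasoning

  -- Euler's theorem: u ^ φ(m) ≡ 1 (mod m) for every unit u. The product P of the
  -- reduced residues satisfies u ^ φ(m) * P ≈ P, and P is coprime to m.
  euler : ∀ u v → u * v ≈ 1 → u ^ φ m ≈ 1
  euler u v uv = ≡mod⇒≈ (coprime-divisor (Coprimality.sym P-coprime) m∣δ)
    where
    open Scaling u v uv
    P = product reduced
    U = u ^ φ m
    P-coprime : Coprime P m
    P-coprime = coprime-product reduced (λ p → proj₂ (∈reduced⁻ p))
    UP≈P : U * P ≈ P
    UP≈P = trans (sym (product-scaled reduced)) (cong (_% m) (product-↭ (∼bag⇒↭ scale-permutes)))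
    m∣δ : m ∣ P * ∣ U - 1 ∣
    m∣δ = subst (m ∣_) (sym (trans (*-comm P ∣ U - 1 ∣) (trans (*-distribʳ-∣-∣ P U 1) (cong (λ z → ∣ U * P - z ∣) (*-identityˡ P))))) (≈⇒≡mod UP≈P)

module Powers (m : ℕ) .{{_ : NonZero m}} (a n : ℕ) .{{_ : NonZero n}} (period : Congruence._≈_ m (a ^ (n + 1)) a) where
  open Congruence m
  open ≈-Reasoning

  ^-≡ : ∀ {x y} → x ≡ y → a ^ x ≈ a ^ y
  ^-≡ refl = refl

  ^-+ : ∀ x y → a ^ (x + y) ≈ a ^ x * a ^ y
  ^-+ x y = cong (_% m) (^-distribˡ-+-* a x y)

  shift-period : ∀ j → 1 ≤ j → a ^ (j + n) ≈ a ^ j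
  shift-period (suc i) _ = begin
    a ^ (suc i + n)     ≡⟨ cong (a ^_) (trans (sym (+-suc i n)) (cong (i +_) (+-comm 1 n))) ⟩
    a ^ (i + (n + 1))   ≈⟨ ^-+ i (n + 1) ⟩
    a ^ i * a ^ (n + 1) ≈⟨ *-cong (refl {x = a ^ i % m}) period ⟩
    a ^ i * a           ≡⟨ *-comm (a ^ i) a ⟩
    a ^ suc i           ∎

  periodic : ∀ j t → 1 ≤ j → a ^ (j + t * n) ≈ a ^ j
  periodic j zero    _   = ^-≡ (+-identityʳ j)
  periodic j (suc t) 1≤j = begin
    a ^ (j + (n + t * n)) ≡⟨ cong (a ^_) (trans (cong (j +_) (+-comm n (t * n))) (sym (+-assoc j (t * n) n))) ⟩
    a ^ (j + t * n + n)   ≈⟨ shift-period (j + t * n) (≤-trans 1≤j (m≤m+n j _)) ⟩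
    a ^ (j + t * n)       ≈⟨ periodic j t 1≤j ⟩
    a ^ j                 ∎

  multiple-period : ∀ q → 1 ≤ q → a ^ (q * n) ≈ a ^ n
  multiple-period (suc t) _ = periodic n t (>-nonZero⁻¹ n)

  divisible-shift : ∀ k d → 1 ≤ k → n ∣ d → a ^ (k + d) ≈ a ^ k
  divisible-shift k d 1≤k (divides t refl) = periodic k t 1≤k

  -- If e = a^n is idempotent, then w = 1 - e (represented in ℕ as m - e % m + 1)
  -- makes u = a + w a unit: a·w ≈ 0 and w·w ≈ w, so the positive powers of u
  -- are u^j ≈ a^j + w. Euler's theorem for u then yields a^φ(m) ≈ e.
  module UnitTrick (idem : Idempotent (a ^ n)) where
    open Euler m using (euler; φ-positive)

    e = a ^ n
    w = m ∸ e % m + 1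
    A = a ^ (n ∸ 1)

    a*A≡e : a * A ≡ e
    a*A≡e = cong (a ^_) (m+[n∸m]≡n (>-nonZero⁻¹ n))

    w+e≈1 : w + e ≈ 1
    w+e≈1 = begin
      m ∸ e % m + 1 + e         ≈⟨ +-cong (refl {x = w % m}) (sym (m%n%n≡m%n e m)) ⟩
      m ∸ e % m + 1 + e % m     ≡⟨ +-comm w (e % m) ⟩
      e % m + (m ∸ e % m + 1)   ≡⟨ sym (+-assoc (e % m) (m ∸ e % m) 1) ⟩
      e % m + (m ∸ e % m) + 1   ≡⟨ cong (_+ 1) (m+[n∸m]≡n (m%n≤n e m)) ⟩
      m + 1                     ≡⟨ +-comm m 1 ⟩
      1 + m                     ≈⟨ [m+n]%n≡m%n 1 m ⟩
      1                         ∎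

    a*w≈0 : a * w ≈ 0
    a*w≈0 = +-cancelʳ (a * w) 0 a (begin
      a * w + a     ≈⟨ +-cong (refl {x = a * w % m}) (sym (trans (^-≡ (+-comm 1 n)) period)) ⟩
      a * w + a * e ≡⟨ sym (*-distribˡ-+ a w e) ⟩
      a * (w + e)   ≈⟨ *-cong (refl {x = a % m}) w+e≈1 ⟩
      a * 1         ≡⟨ *-identityʳ a ⟩
      a             ∎)

    w*a*≈0 : ∀ Y → w * (a * Y) ≈ 0
    w*a*≈0 Y = begin
      w * (a * Y) ≡⟨ sym (*-assoc w a Y) ⟩
      w * a * Y   ≡⟨ cong (_* Y) (*-comm w a) ⟩
      a * w * Y   ≈⟨ *-cong a*w≈0 (refl {x = Y % m}) ⟩
      0           ∎

    w*w≈w : w * w ≈ w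
    w*w≈w = begin
      w * w         ≡⟨ sym (+-identityʳ (w * w)) ⟩
      w * w + 0     ≈⟨ +-cong (refl {x = w * w % m}) (sym (subst (λ z → w * z ≈ 0) a*A≡e (w*a*≈0 A))) ⟩
      w * w + w * e ≡⟨ sym (*-distribˡ-+ w w e) ⟩
      w * (w + e)   ≈⟨ *-cong (refl {x = w % m}) w+e≈1 ⟩
      w * 1         ≡⟨ *-identityʳ w ⟩
      w             ∎

    -- Multiplying a·Y + w by u = a + w kills the cross terms.
    u*[aY+w] : ∀ Y → (a + w) * (a * Y + w) ≈ a * (a * Y) + w
    u*[aY+w] Y = begin
      (a + w) * (a * Y + w)                       ≡⟨ expand ⟩
      a * (a * Y) + a * w + (w * (a * Y) + w * w) ≈⟨ +-cong (+-cong (refl {x = a * (a * Y) % m}) a*w≈0) (+-cong (w*a*≈0 Y) w*w≈w) ⟩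
      a * (a * Y) + 0 + (0 + w)                   ≡⟨ cong (_+ w) (+-identityʳ (a * (a * Y))) ⟩
      a * (a * Y) + w                             ∎
      where
      expand : (a + w) * (a * Y + w) ≡ a * (a * Y) + a * w + (w * (a * Y) + w * w)
      expand = trans (*-distribʳ-+ (a * Y + w) a w) (cong₂ _+_ (*-distribˡ-+ a (a * Y) w) (*-distribˡ-+ w (a * Y) w))

    unit-power : ∀ j → 1 ≤ j → (a + w) ^ j ≈ a ^ j + w
    unit-power (suc zero)    _ = cong (_% m) (trans (*-identityʳ (a + w)) (cong (_+ w) (sym (*-identityʳ a))))
    unit-power (suc (suc i)) _ = begin
      (a + w) * (a + w) ^ suc i ≈⟨ *-cong (refl {x = (a + w) % m}) (unit-power (suc i) (s≤s z≤n)) ⟩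
      (a + w) * (a * a ^ i + w) ≈⟨ u*[aY+w] (a ^ i) ⟩
      a * (a * a ^ i) + w       ∎

    -- The inverse of u is a·A·A + w with A = a^(n-1), since a·a·A·A = e·e ≈ e.
    unit-inverse : (a + w) * (a * (A * A) + w) ≈ 1
    unit-inverse = begin
      (a + w) * (a * (A * A) + w) ≈⟨ u*[aY+w] (A * A) ⟩
      a * (a * (A * A)) + w       ≡⟨ cong (_+ w) (trans (sym (*-assoc a a (A * A))) ([m*n]*[o*p]≡[m*o]*[n*p] a a A A)) ⟩
      a * A * (a * A) + w         ≡⟨ cong (λ z → z * z + w) a*A≡e ⟩
      e * e + w                   ≈⟨ +-cong idem (refl {x = w % m}) ⟩
      e + w                       ≡⟨ +-comm e w ⟩
      w + e                       ≈⟨ w+e≈1 ⟩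
      1                           ∎

    a^φ≈e : a ^ φ m ≈ e
    a^φ≈e = +-cancelʳ (a ^ φ m) e w (begin
      a ^ φ m + w   ≈⟨ sym (unit-power (φ m) φ-positive) ⟩
      (a + w) ^ φ m ≈⟨ euler (a + w) (a * (A * A) + w) unit-inverse ⟩
      1             ≈⟨ sym w+e≈1 ⟩
      w + e         ≡⟨ +-comm w e ⟩
      e + w         ∎)

  module Exact (idem : Idempotent (a ^ n)) (minimal : ∀ j → 1 ≤ j → j < n → ¬ Idempotent (a ^ j)) where

    -- From a^k ≈ a^(k+d) with r = d % n ≠ 0 we multiply up to exponent k·n and
    -- obtain a^n ≈ a^r, an idempotent power below n.
    period-divides : ∀ k d → 1 ≤ k → a ^ k ≈ a ^ (k + d) → n ∣ d
    period-divides k d 1≤k a^k≈a^[k+d] with d % n in d%n≡r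
    ... | zero    = m%n≡0⇒n∣m d n d%n≡r
    ... | suc r-1 = ⊥-elim (minimal r (s≤s z≤n) r<n (idempotent-resp-≈ a^n≈a^r idem))
      where
      r = suc r-1
      r<n : r < n
      r<n = subst (_< n) d%n≡r (m%n<n d n)
      d≡r+qn : d ≡ r + (d / n) * n
      d≡r+qn = trans (m≡m%n+[m/n]*n d n) (cong (_+ (d / n) * n) d%n≡r)
      a^k≈a^[k+r] : a ^ k ≈ a ^ (k + r)
      a^k≈a^[k+r] = begin
        a ^ k                   ≈⟨ a^k≈a^[k+d] ⟩
        a ^ (k + d)             ≡⟨ cong (a ^_) (trans (cong (k +_) d≡r+qn) (sym (+-assoc k r _))) ⟩
        a ^ (k + r + d / n * n) ≈⟨ periodic (k + r) (d / n) (≤-trans 1≤k (m≤m+n k r)) ⟩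
        a ^ (k + r)             ∎
      c = k * n ∸ k
      k+c≡kn : k + c ≡ k * n
      k+c≡kn = m+[n∸m]≡n (m≤m*n k n)
      a^n≈a^r : a ^ n ≈ a ^ r
      a^n≈a^r = begin
        a ^ n               ≈⟨ sym (multiple-period k 1≤k) ⟩
        a ^ (k * n)         ≡⟨ cong (a ^_) (sym k+c≡kn) ⟩
        a ^ (k + c)         ≈⟨ ^-+ k c ⟩
        a ^ k * a ^ c       ≈⟨ *-cong a^k≈a^[k+r] (refl {x = a ^ c % m}) ⟩
        a ^ (k + r) * a ^ c ≈⟨ sym (^-+ (k + r) c) ⟩
        a ^ (k + r + c)     ≡⟨ cong (a ^_) (trans (cong (_+ c) (+-comm k r)) (trans (+-assoc r k c) (cong (r +_) k+c≡kn))) ⟩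
        a ^ (r + k * n)     ≈⟨ periodic r k (s≤s z≤n) ⟩
        a ^ r               ∎

    idempotent⇒divides : ∀ j → 1 ≤ j → Idempotent (a ^ j) → n ∣ j
    idempotent⇒divides j 1≤j idem-j = period-divides j j 1≤j (trans (sym idem-j) (sym (^-+ j j)))

    divides⇒idempotent : ∀ j → 1 ≤ j → n ∣ j → Idempotent (a ^ j)
    divides⇒idempotent j 1≤j (divides q refl) =
      idempotent-resp-≈ (sym (multiple-period q (positive-factor q 1≤j))) idem
      where
      positive-factor : ∀ q → 1 ≤ q * n → 1 ≤ q
      positive-factor (suc _) _ = s≤s z≤n

    powers-≈⇔ : ∀ k l → 1 ≤ k → 1 ≤ l → a ^ k ≈ a ^ l ⇔ n ∣ ∣ k - l ∣
    powers-≈⇔ k l 1≤k 1≤l with gap k l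
    ... | below k d = mk⇔ (λ eq → subst (n ∣_) (sym (∣m-m+n∣≡n k d)) (period-divides k d 1≤k eq))
                          (λ n∣ → sym (divisible-shift k d 1≤k (subst (n ∣_) (∣m-m+n∣≡n k d) n∣)))
    ... | above l d = mk⇔ (λ eq → subst (n ∣_) (sym (∣m+n-m∣≡n l d)) (period-divides l d 1≤l (sym eq)))
                          (λ n∣ → divisible-shift l d 1≤l (subst (n ∣_) (∣m+n-m∣≡n l d) n∣))

    -- Part 2: the order n divides φ(m), as a^φ(m) ≈ a^n is idempotent.
    order∣φ : n ∣ φ m
    order∣φ = idempotent⇒divides (φ m) φ-positive (idempotent-resp-≈ (sym a^φ≈e) idem)
      where
      open Euler m using (φ-positive)
      open UnitTrick idem

    -- Part 4: for k ≥ 1 the residue b = a^k mod m has order n / gcd(k, n), since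
    -- b^j ≈ a^(k·j) is idempotent exactly when n ∣ k·j.
    order-of-power : ∀ k → 1 ≤ k → .{{_ : NonZero (gcd k n)}} → IsOrder m ((a ^ k) mod m) (n / gcd k n)
    order-of-power k 1≤k = 1≤n' , idempotent⇒InE (b ^ n') b^n'-idempotent , below-n'
      where
      b  = (a ^ k) mod m
      n' = n / gcd k n
      1≤n' : 1 ≤ n'
      1≤n' = n≢0⇒n>0 (n/gcd[m,n]≢0 k n)
      b^j≈a^kj : ∀ j → b ^ j ≈ a ^ (k * j)
      b^j≈a^kj j = trans (^-cong j (mod-≈ (a ^ k))) (cong (_% m) (^-*-assoc a k j))
      b^n'-idempotent : Idempotent (b ^ n')
      b^n'-idempotent = idempotent-resp-≈ (sym (b^j≈a^kj n'))
        (divides⇒idempotent (k * n') (*-mono-≤ 1≤k 1≤n') (n∣k*[n/gcd] k n))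
      below-n' : ∀ j → 1 ≤ j → j < n' → InE m ((b ^ j) mod m) → ⊥
      below-n' j 1≤j j<n' b^j∈E = <⇒≱ j<n' (∣⇒≤ {{>-nonZero 1≤j}} (n∣k*j⇒n/gcd∣j k n j n∣kj))
        where
        n∣kj : n ∣ k * j
        n∣kj = idempotent⇒divides (k * j) (*-mono-≤ 1≤k 1≤j)
                 (idempotent-resp-≈ (b^j≈a^kj j) (InE⇒idempotent (b ^ j) b^j∈E))

proposition2p5 : (m : ℕ) → .{{_ : NonZero m}} → (a : ℕ) → Regular m a →
    (n : ℕ) → IsOrder m a n →
    (k l : ℕ) → 1 ≤ k → 1 ≤ l →
      (InE m ((a ^ k) mod m) → n ∣ k)
      × n ∣ φ m
      × ((a ^ k ≡ a ^ l [mod m ]) ⇔ (k ≡ l [mod n ]))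
      × IsOrder m ((a ^ k) mod m) (n ÷ gcd k n)
proposition2p5 m a (_ , n' , order' , regular) n order@(1≤n , a^n∈E , below-n) k l 1≤k 1≤l =
    (λ a^k∈E → idempotent⇒divides k 1≤k (InE⇒idempotent (a ^ k) a^k∈E))
  , order∣φ
  , ⇔-trans ≡mod⇔≈ (powers-≈⇔ k l 1≤k 1≤l)
  , subst (IsOrder m ((a ^ k) mod m)) (sym (÷≡/ n (gcd k n))) (order-of-power k 1≤k)
  where
  open Congruence m
  instance
    n-nonZero : NonZero n
    n-nonZero = >-nonZero 1≤n
    gcd-nonZero : NonZero (gcd k n)
    gcd-nonZero = ≢-nonZero (gcd[m,n]≢0 k n (inj₂ (≢-nonZero⁻¹ n)))
  -- Regularity is stated with the order n' from Regular m a, which equals n.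
  period : a ^ (n + 1) ≈ a
  period = subst (λ j → a ^ (j + 1) ≈ a) (order-unique m a order' order) (≡mod⇒≈ regular)
  open Powers m a n period
  open Exact (InE⇒idempotent (a ^ n) a^n∈E)
             (λ j 1≤j j<n idem → below-n j 1≤j j<n (idempotent⇒InE (a ^ j) idem))
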